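{- Let $f$ be an honest function, let $b\ge2$ be a base and let $j\in\mathbb{N}$ be such that $P_j>b$. Let $(0.\mathtt{D}_1\mathtt{D}_2\dots)_b$ be the base-$b$ expansion of $\alpha^f_j$, let $(0.\dot{\mathtt{D}}_1\dot{\mathtt{D}}_2\dots)_b$ be the base-$b$ expansion of $\alpha^f_{j+1}$, and let $M=P_j^{(j+1)h(j)}$ and $M'=h(j+1)$. Then (i) for every $k\in\mathbb{N}\setminus\{0\}$ there exists $i$ with $k\le i<k+M$ and $\mathtt{D}_i\ne0$; and (ii) for all $i\le M'-M$ we have $\mathtt{D}_i=\dot{\mathtt{D}}_i$, and moreover these digits also coincide with the corresponding digits of the base-$b$ expansion of $\alpha^f$.
   Context: For a base $b\ge2$ and digits $\mathtt{D}_i\in\{0,\dots,b-1\}$, $(0.\mathtt{D}_1\dots\mathtt{D}_n)_b=\sum_{i=1}^n\mathtt{D}_ib^{ -i}$; the base-$b$ expansion of a real $\alpha$ is the unique digit sequence $(0.\mathtt{D}_1\mathtt{D}_2\dots)_b$ with $(0.\mathtt{D}_1\dots\mathtt{D}_n)_b\le\alpha<(0.\mathtt{D}_1\dots\mathtt{D}_n)_b+b^{ -n}$ for all $n\ge1$. A function is elementary if generated from $2^x$, $\max$, $0$, successor, projections by composition and bounded primitive recursion; a relation is elementary if its characteristic function is. $f:\mathbb{N}\to\mathbb{N}$ is honest if $f(x)\le f(x+1)$, $f(x)\ge2^x$ and the relation $f(x)=y$ is elementary. $P_i$ is the $i$-th prime ($P_0=2$); $g(0)=1$, $g(j+1)=P_j^{2(j+2)(g(j)+1)^3}$,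 $h(i)=g(f(i)+i)$, $\alpha^f_n=\sum_{i=0}^nP_i^{ -h(i)}$, $\alpha^f=\lim_{n\to\infty}\alpha^f_n$. -}

module Defs where

open import Data.Nat as ℕ using (ℕ; zero; suc; _+_; _*_; _∸_; _^_; _⊔_; NonZero)
open import Data.Nat.Properties using (m^n≢0)
open import Data.Nat.Primality using (Prime; prime⇒nonZero)
open import Data.Integer using (+_)
open import Data.Rational.Unnormalised using (ℚᵘ; 0ℚᵘ; _/_)
  renaming (_+_ to _+q_; _≤_ to _≤q_; _<_ to _<q_)
open import Data.Fin using (Fin)
open import Data.Vec using (Vec; []; _∷_; lookup; tabulate; head)
open import Data.Product using (_×_; ∃-syntax)
open import Data.Bool using (if_then_else_)
open import Relation.Binary.PropositionalEquality using (_≡_)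

primRec : ∀ {n} → (Vec ℕ n → ℕ) → (Vec ℕ (suc (suc n)) → ℕ) → Vec ℕ (suc n) → ℕ
primRec g h (zero  ∷ x) = g x
primRec g h (suc y ∷ x) = h (y ∷ primRec g h (y ∷ x) ∷ x)

data Elementary : (n : ℕ) → (Vec ℕ n → ℕ) → Set where
  zeroᴱ : Elementary 0 (λ _ → 0)
  sucᴱ  : Elementary 1 (λ x → suc (head x))
  expᴱ  : Elementary 1 (λ x → 2 ^ head x)
  maxᴱ  : Elementary 2 (λ x → lookup x Fin.zero ⊔ lookup x (Fin.suc Fin.zero))
  projᴱ : ∀ {n} (i : Fin n) → Elementary n (λ x → lookup x i)
  compᴱ : ∀ {m n} {h : Vec ℕ m → ℕ} {gs : Fin m → Vec ℕ n → ℕ} →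
          Elementary m h → (∀ k → Elementary n (gs k)) →
          Elementary n (λ x → h (tabulate (λ k → gs k x)))
  bprecᴱ : ∀ {n} {g : Vec ℕ n → ℕ} {h : Vec ℕ (suc (suc n)) → ℕ}
             {j : Vec ℕ (suc n) → ℕ} →
           Elementary n g → Elementary (suc (suc n)) h → Elementary (suc n) j →
           (∀ v → primRec g h v ℕ.≤ j v) →
           Elementary (suc n) (primRec g h)
  extᴱ  : ∀ {n} {f f′ : Vec ℕ n → ℕ} →
          Elementary n f → (∀ x → f x ≡ f′ x) → Elementary n f′

ElementaryRel : (n : ℕ) → (Vec ℕ n → Set) → Set
ElementaryRel n R =
  ∃[ χ ] Elementary n χ × (∀ x → (R x → χ x ≡ 1) × (χ x ≡ 1 → R x) × (χ x ℕ.≤ 1))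

record Honest (f : ℕ → ℕ) : Set where
  field
    mono  : ∀ x → f x ℕ.≤ f (suc x)
    big   : ∀ x → 2 ^ x ℕ.≤ f x
    graph : ElementaryRel 2 (λ v → f (lookup v Fin.zero) ≡ lookup v (Fin.suc Fin.zero))

-- The enumeration of the primes: P 0 = 2, P 1 = 3, ... (P i = i-th prime).
-- Specified by: every value prime, strictly increasing, every prime hit.
-- This determines P uniquely.
record PrimeEnum : Set where
  field
    P        : ℕ → ℕ
    isPrime  : ∀ i → Prime (P i)
    strict   : ∀ i → P i ℕ.< P (suc i)
    complete : ∀ p → Prime p → ∃[ i ] P i ≡ p

module _ (E : PrimeEnum) where
  open PrimeEnum E

  g : ℕ → ℕ
  g zero    = 1
  g (suc j) = P j ^ (2 * (j + 2) * (g j + 1) ^ 3)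

  h : (ℕ → ℕ) → ℕ → ℕ
  h f i = g (f i + i)

  term : (ℕ → ℕ) → ℕ → ℚᵘ
  term f i = (+ 1) / (P i ^ h f i)
    where instance _ = prime⇒nonZero (isPrime i)
                   _ = m^n≢0 (P i) (h f i) {{prime⇒nonZero (isPrime i)}}

  alpha : (ℕ → ℕ) → ℕ → ℚᵘ
  alpha f zero    = term f 0
  alpha f (suc n) = alpha f n +q term f (suc n)

-- Base-b expansions. Digit sequences are D : ℕ → ℕ, with D 1, D 2, ...
-- the digits (D 0 is unused).

module _ (b : ℕ) .{{_ : NonZero b}} where

  prefix : (ℕ → ℕ) → ℕ → ℚᵘ
  prefix D zero    = 0ℚᵘ
  prefix D (suc n) = prefix D n +q ((+ D (suc n)) / (b ^ suc n))
    where instance _ = m^n≢0 b (suc n)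

  invPow : ℕ → ℚᵘ
  invPow n = (+ 1) / (b ^ n)
    where instance _ = m^n≢0 b n

  IsDigits : (ℕ → ℕ) → Set
  IsDigits D = ∀ i → 1 ℕ.≤ i → D i ℕ.< b

  IsExpansion : ℚᵘ → (ℕ → ℕ) → Set
  IsExpansion q D = IsDigits D ×
    (∀ n → 1 ℕ.≤ n → (prefix D n ≤q q) × (q <q prefix D n +q invPow n))

  -- D is the base-b expansion of the real number α = lim a n = sup a n,
  -- for a nondecreasing bounded sequence a of rationals.  Comparisons with α
  -- are expressed through a:
  --   r ≤ α  iff  ∀ ε > 0, ∃ m, r ≤ a m + ε
  --   α < r  iff  ∃ ε > 0, ∀ m, a m + ε ≤ r
  IsExpansionOfLim : (ℕ → ℚᵘ) → (ℕ → ℕ) → Set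
  IsExpansionOfLim a D = IsDigits D ×
    (∀ n → 1 ℕ.≤ n →
      (∀ ε → 0ℚᵘ <q ε → ∃[ m ] prefix D n ≤q a m +q ε) ×
      (∃[ ε ] (0ℚᵘ <q ε) × (∀ m → a m +q ε ≤q prefix D n +q invPow n)))

module Submission where

-- Write α^f_m = A m / Q m with Q m = T 0 * … * T m and T i = P i ^ h i.  The prime P j divides
-- Q j but neither A j nor b, so α^f_j is not of the form c / b ^ K; yet M zero digits after
-- position K would force Q j ∣ A j * b ^ K, because b ^ M > M ≥ Q j.  This gives (i).
-- For (ii), since the T i grow at least geometrically, all later partial sums, hence α^f, lie
-- within 2 / T (j+1) above α^f_j.  For n ≤ M′ ∸ M we have 3 * Q j * b ^ n < T (j+1), so every
-- x ∈ [α^f_j, α^f_j + 3 / T (j+1)] has the same ⌊x b ^ n⌋, i.e. the same first n digits.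

open import Defs
open import Data.Nat as ℕ using (ℕ; zero; suc; _+_; _*_; _∸_; _^_; _≤_; _<_; NonZero; s≤s; z≤n; z<s)
open import Data.Nat.Properties
open import Data.Nat.Divisibility
open import Data.Nat.Primality
open import Data.Fin using (Fin; toℕ; fromℕ<)
open import Data.Fin.Properties using (¬∀⟶∃¬; toℕ<n; toℕ-fromℕ<)
open import Data.Integer as ℤ using (+_; +≤+; +<+)
open import Data.Integer.Properties using (pos-*; pos-+; drop‿+<+)
open import Data.Rational.Unnormalised as Q using (ℚᵘ; _/_; *≤*; *<*; *≡*; _≃_)
  renaming (_+_ to _+q_; _≤_ to _≤q_; _<_ to _<q_)
import Data.Rational.Unnormalised.Properties as QP
open import Data.Product using (_×_; ∃-syntax; _,_; proj₁; proj₂)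
open import Data.Sum using (inj₁; inj₂)
open import Data.Empty using (⊥-elim)
open import Relation.Nullary using (¬_; yes; no)
open import Relation.Binary.Bundles using (Preorder)
open import Relation.Binary.PropositionalEquality
open import Data.Nat.Solver using (module +-*-Solver)
open +-*-Solver

frac-≤⇒cross : ∀ a c d e .{{_ : NonZero d}} .{{_ : NonZero e}} →
               (+ a) / d ≤q (+ c) / e → a * e ≤ c * d
frac-≤⇒cross a c (suc d) (suc e) (*≤* p) =
  ℤ.drop‿+≤+ (subst₂ ℤ._≤_ (sym (pos-* a (suc e))) (sym (pos-* c (suc d))) p)

cross⇒frac-≤ : ∀ a c d e .{{_ : NonZero d}} .{{_ : NonZero e}} →
               a * e ≤ c * d → (+ a) / d ≤q (+ c) / e
cross⇒frac-≤ a c (suc d) (suc e) le =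
  *≤* (subst₂ ℤ._≤_ (pos-* a (suc e)) (pos-* c (suc d)) (+≤+ le))

frac-<⇒cross : ∀ a c d e .{{_ : NonZero d}} .{{_ : NonZero e}} →
               (+ a) / d <q (+ c) / e → a * e < c * d
frac-<⇒cross a c (suc d) (suc e) (*<* p) =
  drop‿+<+ (subst₂ ℤ._<_ (sym (pos-* a (suc e))) (sym (pos-* c (suc d))) p)

cross⇒frac-< : ∀ a c d e .{{_ : NonZero d}} .{{_ : NonZero e}} →
               a * e < c * d → (+ a) / d <q (+ c) / e
cross⇒frac-< a c (suc d) (suc e) lt =
  *<* (subst₂ ℤ._<_ (pos-* a (suc e)) (pos-* c (suc d)) (+<+ lt))

cross⇒frac-≃ : ∀ a c d e .{{_ : NonZero d}} .{{_ : NonZero e}} →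
               a * e ≡ c * d → (+ a) / d ≃ (+ c) / e
cross⇒frac-≃ a c (suc d) (suc e) eq =
  *≡* (trans (sym (pos-* a (suc e))) (trans (cong +_ eq) (pos-* c (suc d))))

frac-+ : ∀ a c d e .{{_ : NonZero d}} .{{_ : NonZero e}} →
         (+ a) / d +q (+ c) / e ≃ _/_ (+ (a * e + c * d)) (d * e) {{m*n≢0 d e}}
frac-+ a c (suc d) (suc e) = *≡* (cong (ℤ._* (+ (suc d * suc e)))
  (trans (cong₂ ℤ._+_ (sym (pos-* a (suc e))) (sym (pos-* c (suc d))))
         (sym (pos-+ (a * suc e) (c * suc d)))))

≤-+-frac : ∀ p a d .{{_ : NonZero d}} → p ≤q p +q (+ a) / d
≤-+-frac p a d = QP.≤-respˡ-≃ (QP.+-identityʳ p) (QP.+-monoʳ-≤ p (cross⇒frac-≤ 0 a 1 d z≤n))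

*-sandwich⇒≤ : ∀ {p q d x} → p * d ≤ x → x < suc q * d → p ≤ q
*-sandwich⇒≤ {p} {q} {d} lo hi = ≤-pred (*-cancelʳ-< d p (suc q) (≤-<-trans lo hi))

*-gap⇒≡ : ∀ {x y w d} → y ≤ x → x * w < y * w + d → d < w → x ≡ y
*-gap⇒≡ {x} {y} {w} {d} y≤x hi d<w = ≤-antisym x≤y y≤x
  where
  x≤y : x ≤ y
  x≤y = ≤-pred (*-cancelʳ-< w x (suc y)
          (<-trans hi (subst (y * w + d <_) (+-comm (y * w) w) (+-monoʳ-< (y * w) d<w))))

floor-shift : ∀ {a p q B c T} → a * B < suc p * q → c * B < T →
              (a * T + c) * B < suc p * (q * T)
floor-shift {a} {p} {q} {B} {c} {T} hi cB<T = begin-strict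
  (a * T + c) * B      ≡⟨ e₁ a T c B ⟩
  a * B * T + c * B    <⟨ +-monoʳ-< (a * B * T) cB<T ⟩
  a * B * T + T        ≡⟨ +-comm (a * B * T) T ⟩
  suc (a * B) * T      ≤⟨ *-monoˡ-≤ T hi ⟩
  suc p * q * T        ≡⟨ *-assoc (suc p) q T ⟩
  suc p * (q * T)      ∎
  where
  open ≤-Reasoning
  e₁ : ∀ a t c x → (a * t + c) * x ≡ a * x * t + c * x
  e₁ = solve 4 (λ a t c x → (a :* t :+ c) :* x := a :* x :* t :+ c :* x) refl

module Digits (b : ℕ) .{{_ : NonZero b}} where

  private
    b^≢0 : ∀ n → NonZero (b ^ n)
    b^≢0 n = m^n≢0 b n

  _/b^_ : ℕ → ℕ → ℚᵘ
  v /b^ n = _/_ (+ v) (b ^ n) {{b^≢0 n}}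

  prefixValue : (ℕ → ℕ) → ℕ → ℕ
  prefixValue D zero    = 0
  prefixValue D (suc n) = prefixValue D n * b + D (suc n)

  prefix≃ : ∀ D n → prefix b D n ≃ prefixValue D n /b^ n
  prefix≃ D zero    = QP.≃-refl
  prefix≃ D (suc n) = QP.≃-trans (QP.+-congˡ _ (prefix≃ D n))
    (QP.≃-trans (frac-+ v d (b ^ n) (b ^ suc n)) (cross⇒frac-≃ _ _ _ _ (e v d b (b ^ n))))
    where
    v = prefixValue D n
    d = D (suc n)
    instance
      _ = b^≢0 n
      _ = b^≢0 (suc n)
      _ = m*n≢0 (b ^ n) (b ^ suc n)
    e : ∀ v d b x → (v * (b * x) + d * x) * (b * x) ≡ (v * b + d) * (x * (b * x))
    e = solve 4 (λ v d b x → (v :* (b :* x) :+ d :* x) :* (b :* x) := (v :* b :+ d) :* (x :* (b :* x))) refl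

  prefix+invPow≃ : ∀ D n → prefix b D n +q invPow b n ≃ suc (prefixValue D n) /b^ n
  prefix+invPow≃ D n = QP.≃-trans (QP.+-congˡ _ (prefix≃ D n))
    (QP.≃-trans (frac-+ v 1 (b ^ n) (b ^ n)) (cross⇒frac-≃ _ _ _ _ (e v (b ^ n))))
    where
    v = prefixValue D n
    instance
      _ = b^≢0 n
      _ = m*n≢0 (b ^ n) (b ^ n)
    e : ∀ v x → (v * x + 1 * x) * x ≡ (1 + v) * (x * x)
    e = solve 2 (λ v x → (v :* x :+ con 1 :* x) :* x := (con 1 :+ v) :* (x :* x)) refl

  module _ {x : ℚᵘ} {a d : ℕ} .{{_ : NonZero d}} (x≃ : x ≃ (+ a) / d) (D : ℕ → ℕ) where

    prefix≤⇒ : ∀ n → prefix b D n ≤q x → prefixValue D n * d ≤ a * b ^ n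
    prefix≤⇒ n le = frac-≤⇒cross _ a (b ^ n) d {{b^≢0 n}}
      (QP.≤-respʳ-≃ x≃ (QP.≤-respˡ-≃ (prefix≃ D n) le))

    <prefix+invPow⇒ : ∀ n → x <q prefix b D n +q invPow b n → a * b ^ n < suc (prefixValue D n) * d
    <prefix+invPow⇒ n lt =
      frac-<⇒cross a _ d (b ^ n) {{_}} {{b^≢0 n}}
        (QP.<-respˡ-≃ x≃ (QP.<-respʳ-≃ (prefix+invPow≃ D n) lt))

    expansion-lower : IsExpansion b x D → ∀ n → prefixValue D n * d ≤ a * b ^ n
    expansion-lower _         zero    = z≤n
    expansion-lower (_ , bnd) (suc n) = prefix≤⇒ (suc n) (proj₁ (bnd (suc n) (s≤s z≤n)))

    expansion-upper : IsExpansion b x D → ∀ n → 1 ≤ n → a * b ^ n < suc (prefixValue D n) * d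
    expansion-upper (_ , bnd) n 1≤n = <prefix+invPow⇒ n (proj₂ (bnd n 1≤n))

  prefixValue-zeros : ∀ D K L → (∀ l → l < L → D (suc (l + K)) ≡ 0) →
                      prefixValue D (L + K) ≡ prefixValue D K * b ^ L
  prefixValue-zeros D K zero    _     = sym (*-identityʳ _)
  prefixValue-zeros D K (suc L) zeros = begin
    prefixValue D (L + K) * b + D (suc (L + K))
      ≡⟨ cong₂ (λ v z → v * b + z) (prefixValue-zeros D K L (λ l l<L → zeros l (m<n⇒m<1+n l<L)))
                                   (zeros L ≤-refl) ⟩
    prefixValue D K * b ^ L * b + 0                   ≡⟨ e (prefixValue D K) (b ^ L) b ⟩
    prefixValue D K * (b * b ^ L)                     ∎
    where
    open ≡-Reasoning
    e : ∀ v y b → v * y * b + 0 ≡ v * (b * y)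
    e = solve 3 (λ v y b → v :* y :* b :+ con 0 := v :* (b :* y)) refl

  prefixValue-≡⇒digit-≡ : ∀ {D D′ N} → (∀ n → n ≤ N → prefixValue D n ≡ prefixValue D′ n) →
                          ∀ i → 1 ≤ i → i ≤ N → D i ≡ D′ i
  prefixValue-≡⇒digit-≡ {D} {D′} same (suc i) _ i<N =
    +-cancelˡ-≡ (prefixValue D i * b) (D (suc i)) (D′ (suc i))
      (trans (same (suc i) i<N)
             (cong (λ v → v * b + D′ (suc i)) (sym (same i (<⇒≤ i<N)))))

  -- The zeros make ⌊a b ^ (L + K) / d⌋ = ⌊a b ^ K / d⌋ b ^ L, so the remainder of a b ^ K mod d,
  -- multiplied by b ^ L > d, stays below d: it must vanish.
  zeros⇒∣ : ∀ {x a d} .{{_ : NonZero d}} → x ≃ (+ a) / d → ∀ {D} → IsExpansion b x D →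
            ∀ K L → d < b ^ L → (∀ l → l < L → D (suc (l + K)) ≡ 0) → d ∣ a * b ^ K
  zeros⇒∣ {d = d} _ _ K zero d<1 _ = ⊥-elim (<⇒≱ d<1 (ℕ.>-nonZero⁻¹ d))
  zeros⇒∣ {a = a} {d} x≃ {D} ex K L@(suc _) d<b^L zeros =
    divides v (*-gap⇒≡ (expansion-lower x≃ D ex K) hi d<b^L)
    where
    v = prefixValue D K
    hi : a * b ^ K * b ^ L < v * d * b ^ L + d
    hi = subst₂ _<_
      (trans (cong (a *_) (^-distribˡ-+-* b L K)) (e₁ a (b ^ L) (b ^ K)))
      (trans (cong (λ w → suc w * d) (prefixValue-zeros D K L zeros)) (e₂ v (b ^ L) d))
      (expansion-upper x≃ D ex (L + K) (s≤s z≤n))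
      where
      e₁ : ∀ a w c → a * (w * c) ≡ a * c * w
      e₁ = solve 3 (λ a w c → a :* (w :* c) := a :* c :* w) refl
      e₂ : ∀ v w d → (1 + v * w) * d ≡ v * d * w + d
      e₂ = solve 3 (λ v w d → (con 1 :+ v :* w) :* d := v :* d :* w :+ d) refl

n<2^n : ∀ n → n < 2 ^ n
n<2^n zero    = z<s
n<2^n (suc n) = subst (_≤ 2 ^ suc n) (+-comm (suc n) 1)
  (+-mono-≤ (n<2^n n) (subst (1 ≤_) (sym (+-identityʳ (2 ^ n))) (m^n>0 2 n)))

3*n<4^n : ∀ n → 3 * n < 4 ^ n
3*n<4^n zero    = z<s
3*n<4^n (suc n) = subst₂ _<_ (sym (*-suc 3 n)) (e (4 ^ n))
  (+-mono-≤-< (*-monoʳ-≤ 3 (m^n>0 4 n)) (3*n<4^n n))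
  where
  e : ∀ x → 3 * x + x ≡ 4 * x
  e = solve 1 (λ x → con 3 :* x :+ x := con 4 :* x) refl

module _ {c ℓ₁ ℓ₂} (𝒫 : Preorder c ℓ₁ ℓ₂) where
  open Preorder 𝒫 using (Carrier; _≲_) renaming (refl to ≲-refl; trans to ≲-trans)

  suc-mono⇒mono : {u : ℕ → Carrier} → (∀ n → u n ≲ u (suc n)) → ∀ {m n} → m ≤ n → u m ≲ u n
  suc-mono⇒mono {u} step {m} {n} m≤n = subst (λ k → u m ≲ u k) (m∸n+n≡m m≤n) (up (n ∸ m))
    where
    up : ∀ d → u m ≲ u (d + m)
    up zero    = ≲-refl
    up (suc d) = ≲-trans (up d) (step (d + m))

module _ {u : ℕ → ℕ} (step : ∀ n → u n < u (suc n)) where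

  suc-strict⇒mono : ∀ {m n} → m ≤ n → u m ≤ u n
  suc-strict⇒mono = suc-mono⇒mono ≤-preorder (λ n → <⇒≤ (step n))

  suc-strict⇒strict : ∀ {m n} → m < n → u m < u n
  suc-strict⇒strict {m} m<n = <-≤-trans (step m) (suc-strict⇒mono m<n)

  suc-strict⇒+-≤ : ∀ d m → u m + d ≤ u (d + m)
  suc-strict⇒+-≤ zero    m = ≤-reflexive (+-identityʳ (u m))
  suc-strict⇒+-≤ (suc d) m = subst (_≤ u (suc d + m)) (sym (+-suc (u m) d))
    (≤-<-trans (suc-strict⇒+-≤ d m) (step (d + m)))

m∣m^n : ∀ m {n} → 1 ≤ n → m ∣ m ^ n
m∣m^n m {suc n} _ = m∣m*n (m ^ n)

prime∣m^n⇒prime∣m : ∀ {p m} → Prime p → ∀ n → p ∣ m ^ n → p ∣ m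
prime∣m^n⇒prime∣m p-prime zero    p∣1 =
  ⊥-elim (ℕ.nonTrivial⇒≢1 {{prime⇒nonTrivial p-prime}} (∣1⇒≡1 p∣1))
prime∣m^n⇒prime∣m {m = m} p-prime (suc n) p∣m^[1+n] with euclidsLemma m (m ^ n) p-prime p∣m^[1+n]
... | inj₁ p∣m   = p∣m
... | inj₂ p∣m^n = prime∣m^n⇒prime∣m p-prime n p∣m^n

module Sequence (E : PrimeEnum) (f : ℕ → ℕ) (honest : Honest f) where
  open PrimeEnum E
  open Honest honest

  P≢0 : ∀ i → NonZero (P i)
  P≢0 i = prime⇒nonZero (isPrime i)

  2≤P : ∀ i → 2 ≤ P i
  2≤P i = ℕ.nonTrivial⇒n>1 (P i) {{prime⇒nonTrivial (isPrime i)}}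

  P-mono : ∀ {i k} → i ≤ k → P i ≤ P k
  P-mono = suc-strict⇒mono strict

  P-strict : ∀ {i k} → i < k → P i < P k
  P-strict = suc-strict⇒strict strict

  g-suc : ∀ x → g E x < g E (suc x)
  g-suc x = <-≤-trans (n<2^n (g E x))
    (≤-trans (^-monoˡ-≤ (g E x) (2≤P x)) (^-monoʳ-≤ (P x) {{P≢0 x}} g≤exponent))
    where
    c = g E x + 1
    instance
      c≢0 : NonZero c
      c≢0 = ℕ.>-nonZero (m≤n+m 1 (g E x))
      c²≢0 : NonZero (c ^ 2)
      c²≢0 = m^n≢0 c 2
      2[x+2]≢0 : NonZero (2 * (x + 2))
      2[x+2]≢0 = ℕ.>-nonZero (*-mono-≤ {1} {2} (s≤s z≤n) (≤-trans (s≤s z≤n) (m≤n+m 2 x)))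
    g≤exponent : g E x ≤ 2 * (x + 2) * c ^ 3
    g≤exponent = ≤-trans (m≤m+n (g E x) 1) (≤-trans (m≤m*n c (c ^ 2)) (m≤n*m (c ^ 3) (2 * (x + 2))))

  g-pos : ∀ x → 1 ≤ g E x
  g-pos zero    = ≤-refl
  g-pos (suc x) = m^n>0 (P x) {{P≢0 x}} (2 * (x + 2) * (g E x + 1) ^ 3)

  h-suc : ∀ i → h E f i < h E f (suc i)
  h-suc i = suc-strict⇒strict g-suc (+-mono-≤-< (mono i) (n<1+n i))

  h-mono : ∀ {i k} → i ≤ k → h E f i ≤ h E f k
  h-mono = suc-strict⇒mono h-suc

  T : ℕ → ℕ
  T i = P i ^ h E f i

  T≢0 : ∀ i → NonZero (T i)
  T≢0 i = m^n≢0 (P i) (h E f i) {{P≢0 i}}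

  Q : ℕ → ℕ
  Q zero    = T 0
  Q (suc m) = Q m * T (suc m)

  A : ℕ → ℕ
  A zero    = 1
  A (suc m) = A m * T (suc m) + Q m

  Q≢0 : ∀ m → NonZero (Q m)
  Q≢0 zero    = T≢0 0
  Q≢0 (suc m) = m*n≢0 (Q m) (T (suc m)) {{Q≢0 m}} {{T≢0 (suc m)}}

  alpha≃A/Q : ∀ m → alpha E f m ≃ _/_ (+ A m) (Q m) {{Q≢0 m}}
  alpha≃A/Q zero    = QP.≃-refl
  alpha≃A/Q (suc m) = QP.≃-trans (QP.+-congˡ (term E f (suc m)) (alpha≃A/Q m))
    (QP.≃-trans (frac-+ (A m) 1 (Q m) (T (suc m)))
      (cross⇒frac-≃ _ _ _ _ (cong (λ n → (A m * T (suc m) + n) * Q (suc m)) (*-identityˡ (Q m)))))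
    where
    instance
      _ = Q≢0 m
      _ = T≢0 (suc m)
      _ = Q≢0 (suc m)

  P∣T : ∀ i → P i ∣ T i
  P∣T i = m∣m^n (P i) (g-pos (f i + i))

  P∣Q : ∀ m → P m ∣ Q m
  P∣Q zero    = P∣T 0
  P∣Q (suc m) = ∣n⇒∣m*n (Q m) (P∣T (suc m))

  P∤T : ∀ {i k} → i < k → ¬ (P k ∣ T i)
  P∤T {i} {k} i<k Pk∣Ti =
    <⇒≱ (P-strict i<k) (∣⇒≤ {{P≢0 i}} (prime∣m^n⇒prime∣m (isPrime k) (h E f i) Pk∣Ti))

  P∤Q : ∀ {m k} → m < k → ¬ (P k ∣ Q m)
  P∤Q {zero}  m<k = P∤T m<k
  P∤Q {suc m} {k} m<k Pk∣Q with euclidsLemma (Q m) (T (suc m)) (isPrime k) Pk∣Q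
  ... | inj₁ Pk∣Qm = P∤Q (<-trans (n<1+n m) m<k) Pk∣Qm
  ... | inj₂ Pk∣T  = P∤T m<k Pk∣T

  P∤A : ∀ m → ¬ (P m ∣ A m)
  P∤A zero    P0∣1 = <⇒≱ (2≤P 0) (≤-reflexive (∣1⇒≡1 P0∣1))
  P∤A (suc m) Pm∣A = P∤Q (n<1+n m) (∣m+n∣m⇒∣n Pm∣A (∣n⇒∣m*n (A m) (P∣T (suc m))))

  T≤ : ∀ {i k} → i ≤ k → T i ≤ P k ^ h E f k
  T≤ {i} {k} i≤k =
    ≤-trans (^-monoˡ-≤ (h E f i) (P-mono i≤k)) (^-monoʳ-≤ (P k) {{P≢0 k}} (h-mono i≤k))

  Q≤ : ∀ {m k} → m ≤ k → Q m ≤ P k ^ (suc m * h E f k)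
  Q≤ {zero}  {k} 0≤k  = subst (λ e → T 0 ≤ P k ^ e) (sym (+-identityʳ (h E f k))) (T≤ 0≤k)
  Q≤ {suc m} {k} m<k = ≤-trans (*-mono-≤ (Q≤ (<⇒≤ m<k)) (T≤ m<k))
    (≤-reflexive (trans (sym (^-distribˡ-+-* (P k) (suc m * h E f k) (h E f k)))
                        (cong (P k ^_) (+-comm (suc m * h E f k) (h E f k)))))

  2^k*T≤T : ∀ k i → 2 ^ k * T i ≤ T (k + i)
  2^k*T≤T k i = begin
    2 ^ k * T i               ≤⟨ *-monoˡ-≤ (T i) (^-monoˡ-≤ k (2≤P i)) ⟩
    P i ^ k * P i ^ h E f i   ≡⟨ sym (^-distribˡ-+-* (P i) k (h E f i)) ⟩
    P i ^ (k + h E f i)       ≤⟨ ^-monoʳ-≤ (P i) {{P≢0 i}} (subst (_≤ h E f (k + i)) (+-comm (h E f i) k)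
                                                          (suc-strict⇒+-≤ h-suc k i)) ⟩
    P i ^ h E f (k + i)       ≤⟨ ^-monoˡ-≤ (h E f (k + i)) (P-mono (m≤n+m i k)) ⟩
    T (k + i)                 ∎
    where open ≤-Reasoning

  alpha-mono : ∀ {m n} → m ≤ n → alpha E f m ≤q alpha E f n
  alpha-mono = suc-mono⇒mono QP.≤-preorder (λ m → ≤-+-frac (alpha E f m) 1 (T (suc m)) {{T≢0 (suc m)}})

  2^k*T≢0 : ∀ k i → NonZero (2 ^ k * T i)
  2^k*T≢0 k i = m*n≢0 (2 ^ k) (T i) {{m^n≢0 2 k}} {{T≢0 i}}

  -- Invariant of the geometric tail estimate: as T (k + 1 + i) ≥ 2 ^ k * T (1 + i), the terms
  -- still to come never exceed the slack 1 / (2 ^ k * T (1 + i)).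
  alpha-tail : ∀ i k → alpha E f (k + suc i) +q _/_ (+ 1) (2 ^ k * T (suc i)) {{2^k*T≢0 k (suc i)}}
                       ≤q alpha E f i +q _/_ (+ 2) (T (suc i)) {{T≢0 (suc i)}}
  alpha-tail i zero = QP.≤-reflexive (QP.≃-trans
    (QP.+-assoc (alpha E f i) (term E f (suc i)) _)
    (QP.+-congʳ (alpha E f i) (QP.≃-trans (frac-+ 1 1 t (1 * t)) (cross⇒frac-≃ _ 2 _ t (e t)))))
    where
    t = T (suc i)
    instance
      _ = T≢0 (suc i)
      _ = 2^k*T≢0 0 (suc i)
      _ = m*n≢0 t (1 * t)
    e : ∀ t → (1 * (1 * t) + 1 * t) * t ≡ 2 * (t * (1 * t))
    e = solve 1 (λ t → (con 1 :* (con 1 :* t) :+ con 1 :* t) :* t := con 2 :* (t :* (con 1 :* t))) refl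
  alpha-tail i (suc k) = begin
    alpha E f m +q term E f (suc m) +q 1/d′
      ≤⟨ QP.+-monoˡ-≤ 1/d′ (QP.+-monoʳ-≤ (alpha E f m) term≤1/d′) ⟩
    alpha E f m +q 1/d′ +q 1/d′              ≃⟨ QP.+-assoc (alpha E f m) 1/d′ 1/d′ ⟩
    alpha E f m +q (1/d′ +q 1/d′)            ≃⟨ QP.+-congʳ (alpha E f m) halves ⟩
    alpha E f m +q (+ 1) / d                 ≤⟨ alpha-tail i k ⟩
    alpha E f i +q (+ 2) / T (suc i)         ∎
    where
    open QP.≤-Reasoning
    m = k + suc i
    d = 2 ^ k * T (suc i)
    d′ = 2 ^ suc k * T (suc i)
    instance
      _ = T≢0 (suc i)
      _ = T≢0 (suc m)
      _ = 2^k*T≢0 k (suc i)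
      _ = 2^k*T≢0 (suc k) (suc i)
      _ = m*n≢0 d′ d′
    1/d′ = (+ 1) / d′
    term≤1/d′ : term E f (suc m) ≤q 1/d′
    term≤1/d′ = cross⇒frac-≤ 1 1 _ _ (*-monoʳ-≤ 1 (2^k*T≤T (suc k) (suc i)))
    halves : 1/d′ +q 1/d′ ≃ (+ 1) / d
    halves = QP.≃-trans (frac-+ 1 1 d′ d′) (cross⇒frac-≃ _ 1 _ d (e (2 ^ k) (T (suc i))))
      where
      e : ∀ p t → (1 * (2 * p * t) + 1 * (2 * p * t)) * (p * t) ≡ 1 * (2 * p * t * (2 * p * t))
      e = solve 2 (λ p t → (con 1 :* (con 2 :* p :* t) :+ con 1 :* (con 2 :* p :* t)) :* (p :* t)
                          := con 1 :* (con 2 :* p :* t :* (con 2 :* p :* t))) refl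

  alpha≤alpha+2/T : ∀ i m → alpha E f m ≤q alpha E f i +q _/_ (+ 2) (T (suc i)) {{T≢0 (suc i)}}
  alpha≤alpha+2/T i m with m ≤? i
  ... | yes m≤i = QP.≤-trans (alpha-mono m≤i) (≤-+-frac (alpha E f i) 2 (T (suc i)) {{T≢0 (suc i)}})
  ... | no  m≰i = subst (λ n → alpha E f n ≤q _) (m∸n+n≡m (≰⇒> m≰i))
    (QP.≤-trans (≤-+-frac (alpha E f (m ∸ suc i + suc i)) 1 _ {{2^k*T≢0 (m ∸ suc i) (suc i)}})
                (alpha-tail i (m ∸ suc i)))

module Stage (E : PrimeEnum) (f : ℕ → ℕ) (honest : Honest f)
             (b : ℕ) .{{_ : NonZero b}} (2≤b : 2 ≤ b)
             (j : ℕ) (b<Pj : b < PrimeEnum.P E j) where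
  open PrimeEnum E
  open Sequence E f honest
  open Digits b

  M M′ : ℕ
  M  = P j ^ ((j + 1) * h E f j)
  M′ = h E f (1 + j)

  private instance
    Qj≢0  : NonZero (Q j)
    Qj≢0  = Q≢0 j
    T≢0′  : NonZero (T (suc j))
    T≢0′  = T≢0 (suc j)
    QT≢0  : NonZero (Q j * T (suc j))
    QT≢0  = m*n≢0 (Q j) (T (suc j))

  Qj≤M : Q j ≤ M
  Qj≤M = subst (λ e → Q j ≤ P j ^ (e * h E f j)) (+-comm 1 j) (Q≤ ≤-refl)

  Qj<b^M : Q j < b ^ M
  Qj<b^M = ≤-<-trans Qj≤M (<-≤-trans (n<2^n M) (^-monoˡ-≤ M 2≤b))

  -- b ^ n ≤ T (j+1) / P (j+1) ^ M for n ≤ M′ ∸ M, and P (j+1) ^ M beats 3 * M.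
  3*Qj*b^n<T : ∀ n → 1 ≤ n → n ≤ M′ ∸ M → 3 * Q j * b ^ n < T (suc j)
  3*Qj*b^n<T n 1≤n n≤ = begin-strict
    3 * Q j * b ^ n
      ≤⟨ *-mono-≤ (*-monoʳ-≤ 3 Qj≤M) (≤-trans (^-monoˡ-≤ n b≤R) (^-monoʳ-≤ R n≤)) ⟩
    3 * M * R ^ (M′ ∸ M)
      <⟨ *-monoˡ-< (R ^ (M′ ∸ M)) {{m^n≢0 R (M′ ∸ M)}} (<-≤-trans (3*n<4^n M) (^-monoˡ-≤ M 4≤R)) ⟩
    R ^ M * R ^ (M′ ∸ M)     ≡⟨ sym (^-distribˡ-+-* R M (M′ ∸ M)) ⟩
    R ^ (M + (M′ ∸ M))       ≡⟨ cong (R ^_) (m+[n∸m]≡n M≤M′) ⟩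
    T (suc j)                ∎
    where
    open ≤-Reasoning
    R = P (suc j)
    instance _ = P≢0 (suc j)
    M≤M′ : M ≤ M′
    M≤M′ = <⇒≤ (m∸n≢0⇒n<m {M′} {M} (λ eq → <⇒≱ (≤-trans 1≤n n≤) (≤-reflexive eq)))
    b≤R : b ≤ R
    b≤R = <⇒≤ (<-trans b<Pj (P-strict (n<1+n j)))
    4≤R : 4 ≤ R
    4≤R = ≤-<-trans (≤-<-trans 2≤b b<Pj) (P-strict (n<1+n j))

  Pj∤A*b^K : ∀ K → ¬ (P j ∣ A j * b ^ K)
  Pj∤A*b^K K Pj∣ with euclidsLemma (A j) (b ^ K) (isPrime j) Pj∣
  ... | inj₁ Pj∣A   = P∤A j Pj∣A
  ... | inj₂ Pj∣b^K = <⇒≱ b<Pj (∣⇒≤ (prime∣m^n⇒prime∣m (isPrime j) K Pj∣b^K))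

  nonzero-digit : ∀ {D} → IsExpansion b (alpha E f j) D →
                  ∀ k → 1 ≤ k → ∃[ i ] (k ≤ i × i < k + M × D i ≢ 0)
  nonzero-digit {D} ex (suc K) _ = suc (toℕ l + K) , s≤s (m≤n+m K (toℕ l)) , s≤s in-window , Dl≢0
    where
    digit : Fin M → ℕ
    digit l = D (suc (toℕ l + K))
    no-zero-run : ¬ (∀ l → digit l ≡ 0)
    no-zero-run zeros = Pj∤A*b^K K (∣-trans (P∣Q j) (zeros⇒∣ (alpha≃A/Q j) ex K M Qj<b^M zeros′))
      where
      zeros′ : ∀ l → l < M → D (suc (l + K)) ≡ 0
      zeros′ l l<M = subst (λ n → D (suc (n + K)) ≡ 0) (toℕ-fromℕ< l<M) (zeros (fromℕ< l<M))
    nonzero = ¬∀⟶∃¬ M (λ l → digit l ≡ 0) (λ l → digit l ≟ 0) no-zero-run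
    l = proj₁ nonzero
    Dl≢0 = proj₂ nonzero
    in-window : toℕ l + K < K + M
    in-window = subst (_< K + M) (+-comm K (toℕ l)) (+-monoʳ-< K (toℕ<n l))

  3/T : ℚᵘ
  3/T = (+ 3) / T (suc j)

  alpha+3/T≃ : alpha E f j +q 3/T ≃ (+ (A j * T (suc j) + 3 * Q j)) / (Q j * T (suc j))
  alpha+3/T≃ = QP.≃-trans (QP.+-congˡ 3/T (alpha≃A/Q j)) (frac-+ (A j) 3 (Q j) (T (suc j)))

  PrefixNear : (ℕ → ℕ) → ℕ → Set
  PrefixNear D̃ n = (alpha E f j <q prefix b D̃ n +q invPow b n) × (prefix b D̃ n ≤q alpha E f j +q 3/T)

  prefixValue-agrees : ∀ {D D̃} → IsExpansion b (alpha E f j) D →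
                       ∀ n → 1 ≤ n → n ≤ M′ ∸ M → PrefixNear D̃ n →
                       prefixValue D n ≡ prefixValue D̃ n
  prefixValue-agrees {D} {D̃} ex n 1≤n n≤ (below , above) = ≤-antisym
    (*-sandwich⇒≤ (expansion-lower (alpha≃A/Q j) D ex n) (<prefix+invPow⇒ (alpha≃A/Q j) D̃ n below))
    (*-sandwich⇒≤ (prefix≤⇒ alpha+3/T≃ D̃ n above)
                  (floor-shift {a = A j} {p = prefixValue D n} {q = Q j} {c = 3 * Q j}
                               (expansion-upper (alpha≃A/Q j) D ex n 1≤n) (3*Qj*b^n<T n 1≤n n≤)))

  digits-agree : ∀ {D D̃} → IsExpansion b (alpha E f j) D → (∀ n → 1 ≤ n → PrefixNear D̃ n) →
                 ∀ i → 1 ≤ i → i ≤ M′ ∸ M → D i ≡ D̃ i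
  digits-agree {D} {D̃} ex near = prefixValue-≡⇒digit-≡ same
    where
    same : ∀ n → n ≤ M′ ∸ M → prefixValue D n ≡ prefixValue D̃ n
    same zero    _  = refl
    same (suc n) n≤ = prefixValue-agrees ex (suc n) (s≤s z≤n) n≤ (near (suc n) (s≤s z≤n))

  next-near : ∀ {D′} → IsExpansion b (alpha E f (1 + j)) D′ → ∀ n → 1 ≤ n → PrefixNear D′ n
  next-near (_ , bounds) n 1≤n =
    QP.≤-<-trans (alpha-mono (n≤1+n j)) (proj₂ (bounds n 1≤n)) ,
    QP.≤-trans (proj₁ (bounds n 1≤n))
               (QP.+-monoʳ-≤ (alpha E f j)
                 (cross⇒frac-≤ 1 3 _ _ (*-monoˡ-≤ (T (suc j)) {1} {3} (s≤s z≤n))))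

  limit-near : ∀ {Dα} → IsExpansionOfLim b (alpha E f) Dα → ∀ n → 1 ≤ n → PrefixNear Dα n
  limit-near (_ , bounds) n 1≤n with bounds n 1≤n
  ... | below , (ε , 0<ε , above) with below ((+ 1) / T (suc j)) (cross⇒frac-< 0 1 1 (T (suc j)) (s≤s z≤n))
  ...   | m , prefix≤alpha+1/T =
    QP.<-≤-trans (QP.<-respˡ-≃ (QP.+-identityʳ (alpha E f j)) (QP.+-monoʳ-< (alpha E f j) 0<ε)) (above j) ,
    QP.≤-trans prefix≤alpha+1/T (QP.≤-respʳ-≃ 2/T+1/T≃3/T
      (QP.+-monoˡ-≤ ((+ 1) / T (suc j)) (alpha≤alpha+2/T j m)))
    where
    t = T (suc j)
    2/T+1/T≃3/T : alpha E f j +q (+ 2) / t +q (+ 1) / t ≃ alpha E f j +q 3/T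
    2/T+1/T≃3/T = QP.≃-trans (QP.+-assoc (alpha E f j) _ _) (QP.+-congʳ (alpha E f j)
      (QP.≃-trans (frac-+ 2 1 t t) (cross⇒frac-≃ _ 3 (t * t) t {{m*n≢0 t t}} (e t))))
      where
      e : ∀ t → (2 * t + 1 * t) * t ≡ 3 * (t * t)
      e = solve 1 (λ t → (con 2 :* t :+ con 1 :* t) :* t := con 3 :* (t :* t)) refl

lemma3 : (E : PrimeEnum) (f : ℕ → ℕ) → Honest f →
         (b : ℕ) .{{_ : NonZero b}} → 2 ≤ b →
         (j : ℕ) → b < PrimeEnum.P E j →
         (D D′ Dα : ℕ → ℕ) →
         IsExpansion b (alpha E f j) D →
         IsExpansion b (alpha E f (1 + j)) D′ →
         IsExpansionOfLim b (alpha E f) Dα →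
         let M  = PrimeEnum.P E j ^ ((j + 1) * h E f j)
             M′ = h E f (1 + j)
         in (∀ k → 1 ≤ k → ∃[ i ] (k ≤ i × i < k + M × D i ≢ 0))
            × (∀ i → 1 ≤ i → i ≤ M′ ∸ M → D i ≡ D′ i × D i ≡ Dα i)
lemma3 E f honest b 2≤b j b<Pj D D′ Dα ex ex′ lim =
  nonzero-digit ex ,
  λ i 1≤i i≤ → digits-agree ex (next-near ex′) i 1≤i i≤ , digits-agree ex (limit-near lim) i 1≤i i≤
  where open Stage E f honest b 2≤b j b<Pj
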